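{- In the game $\tilde{R}(P_{10},P_n)$ (for any positive integer $n$), if Painter follows the Strategy described in the context, then, whatever Builder does, no red copy of $P_{10}$ is ever created.
   Context: $P_\ell$ is the path on $\ell$ vertices. The game $\tilde{R}(G,H)$: Builder and Painter play on vertex set $\mathbb{N}$; each round Builder selects a previously unselected edge and Painter colours it red or blue; the game ends when a red copy of $G$ or a blue copy of $H$ exists. Red (blue) graph = graph of red (blue) edges; a red component is a connected component of the red graph containing at least one edge (a vertex with no incident red edge lies in no red component). A red component is small if it is a single red edge (a copy of $P_2$), and large otherwise. Every vertex of a large red component carries a label: central, outer, or terminal (labels, once assigned, are never changed). Strategy for Painter: let $xy$ be the edge Builder just selected; in each case $x$ and $y$ are interchangeable. Painter checks the cases below in order and applies the first that holds. Red cases: (A) Neither $x$ nor $y$ is incident to any red edge: colour red. (B) $x$ is in a small red component and $y$ is incident to no red edge: colour red; all three vertices of the new red component are labelled central. (C) $x$ and $y$ lie in two different small red components: colour red; Painter chooses three consecutive vertices of the resulting red $P_4$ and labels them central, and labels the fourth vertex outer. (D) $x$ is a central vertex of a large red component and $y$ is incident to no red edge: colour red; label $y$ outer. (E) $x$ is a central vertex of a large red component and $y$ lies in a small red component: colour red; label $y$ and the other vertex of that small component outer. (F) $x$ is an outer vertex of a large red component and $y$ is incident to exactly one blue edge and no red edges: colour red; label $y$ terminal. Blue cases (otherwise): (G) $x$ or $y$ is incident to at least $2$ blue edges. (H) $x$ is an outer vertex of a large red component and $y$ is incident to no red and no blue edge. (I) $x$ is an outer vertex of a large red component and $y$ lies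 in a small red component. (J) $x$ is a terminal vertex of a large red component. (K) $x$ and $y$ both lie in large red components. In cases (G)–(K) Painter colours $xy$ blue. (These cases cover every possible edge.) -}

module Defs where

open import Data.Nat using (ℕ; suc; _≟_)
open import Data.Fin using (Fin; toℕ)
open import Data.List using (List; []; _∷_)
open import Data.List.Relation.Unary.Any using (Any)
open import Data.Maybe using (Maybe; just; nothing)
open import Data.Product using (Σ; ∃; _×_; _,_)
open import Data.Sum using (_⊎_)
open import Relation.Nullary using (¬_; yes; no)
open import Relation.Binary.PropositionalEquality using (_≡_; _≢_)
open import Relation.Binary.Construct.Closure.ReflexiveTransitive using (Star)
open import Function.Definitions using (Injective)

data Colour : Set where
  red blue : Colour

data Label : Set where
  central outer terminal : Label

record Move : Set where
  constructor mv
  field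
    u v : ℕ
    colour : Colour

record State : Set where
  constructor st
  field
    moves : List Move
    label : ℕ → Maybe Label
open State public

initial : State
initial = st [] (λ _ → nothing)

IsEdge : Move → ℕ → ℕ → Set
IsEdge (mv a b _) x y = (a ≡ x × b ≡ y) ⊎ (a ≡ y × b ≡ x)

Selected : State → ℕ → ℕ → Set
Selected s x y = Any (λ m → IsEdge m x y) (moves s)

ColAdj : Colour → State → ℕ → ℕ → Set
ColAdj c s x y = Any (λ m → IsEdge m x y × Move.colour m ≡ c) (moves s)

RedAdj BlueAdj : State → ℕ → ℕ → Set
RedAdj = ColAdj red
BlueAdj = ColAdj blue

HasPath : (ℕ → ℕ → Set) → ℕ → Set
HasPath G ℓ = Σ (Fin ℓ → ℕ) λ f → Injective _≡_ _≡_ f ×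
  (∀ (i j : Fin ℓ) → toℕ j ≡ suc (toℕ i) → G (f i) (f j))

RedConn : State → ℕ → ℕ → Set
RedConn s = Star (RedAdj s)

HasRed NoRed : State → ℕ → Set
HasRed s x = ∃ λ w → RedAdj s x w
NoRed s x = ¬ HasRed s x

-- x lies in a small red component whose other vertex is w
-- (the red component of x is the single red edge xw)
SmallWith : State → ℕ → ℕ → Set
SmallWith s x w = RedAdj s x w × (∀ z → RedConn s x z → z ≡ x ⊎ z ≡ w)

InSmall : State → ℕ → Set
InSmall s x = ∃ λ w → SmallWith s x w

InLarge : State → ℕ → Set
InLarge s x = HasRed s x × ¬ InSmall s x

HasLabel : Label → State → ℕ → Set
HasLabel l s x = InLarge s x × label s x ≡ just l

Central Outer Terminal : State → ℕ → Set
Central = HasLabel central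
Outer = HasLabel outer
Terminal = HasLabel terminal

ExactlyOneBlue : State → ℕ → Set
ExactlyOneBlue s y = ∃ λ w → BlueAdj s y w × (∀ z → BlueAdj s y z → z ≡ w)

addEdge : Colour → State → ℕ → ℕ → State
addEdge c (st ms l) x y = st (mv x y c ∷ ms) l

relabel : (ℕ → Maybe Label) → ℕ → Label → ℕ → Maybe Label
relabel f v l u with u ≟ v
... | yes _ = just l
... | no _ = f u

setLabel : ℕ → Label → State → State
setLabel v l (st ms f) = st ms (relabel f v l)

CaseA CaseB CaseC CaseD CaseE CaseF : State → ℕ → ℕ → Set
CaseA s x y = NoRed s x × NoRed s y
CaseB s x y = InSmall s x × NoRed s y
CaseC s x y = InSmall s x × InSmall s y × ¬ RedConn s x y
CaseD s x y = Central s x × NoRed s y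
CaseE s x y = Central s x × InSmall s y
CaseF s x y = Outer s x × ExactlyOneBlue s y × NoRed s y

Sym : (State → ℕ → ℕ → Set) → State → ℕ → ℕ → Set
Sym P s x y = P s x y ⊎ P s y x

SomeRedCase : State → ℕ → ℕ → Set
SomeRedCase s x y = Sym CaseA s x y ⊎ Sym CaseB s x y ⊎ Sym CaseC s x y
  ⊎ Sym CaseD s x y ⊎ Sym CaseE s x y ⊎ Sym CaseF s x y

data RedMove (s : State) (x y : ℕ) : State → Set where
  caseA : CaseA s x y → RedMove s x y (addEdge red s x y)
  caseB : ∀ {w} → ¬ Sym CaseA s x y →
          SmallWith s x w → NoRed s y →
          RedMove s x y (setLabel x central (setLabel w central
                           (setLabel y central (addEdge red s x y))))
  -- red P4 is  x' - x - y - y' ; the three consecutive vertices x', x, y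
  -- are central and y' is outer (the other choice arises by swapping x, y)
  caseC : ∀ {x' y'} → ¬ Sym CaseA s x y → ¬ Sym CaseB s x y →
          SmallWith s x x' → SmallWith s y y' → ¬ RedConn s x y →
          RedMove s x y (setLabel x' central (setLabel x central
                           (setLabel y central (setLabel y' outer
                             (addEdge red s x y)))))
  caseD : ¬ Sym CaseA s x y → ¬ Sym CaseB s x y → ¬ Sym CaseC s x y →
          Central s x → NoRed s y →
          RedMove s x y (setLabel y outer (addEdge red s x y))
  caseE : ∀ {w} → ¬ Sym CaseA s x y → ¬ Sym CaseB s x y →
          ¬ Sym CaseC s x y → ¬ Sym CaseD s x y →
          Central s x → SmallWith s y w →
          RedMove s x y (setLabel y outer (setLabel w outer (addEdge red s x y)))
  caseF : ¬ Sym CaseA s x y → ¬ Sym CaseB s x y → ¬ Sym CaseC s x y →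
          ¬ Sym CaseD s x y → ¬ Sym CaseE s x y →
          Outer s x → ExactlyOneBlue s y → NoRed s y →
          RedMove s x y (setLabel y terminal (addEdge red s x y))

data Respond (s : State) (x y : ℕ) : State → Set where
  redXY : ∀ {s'} → RedMove s x y s' → Respond s x y s'
  redYX : ∀ {s'} → RedMove s y x s' → Respond s x y s'
  blueXY : ¬ SomeRedCase s x y → Respond s x y (addEdge blue s x y)

-- The game R~(P_10, P_n) with Painter following the strategy and Builder
-- arbitrary: states reachable while the game has not ended.

data Reachable (n : ℕ) : State → Set where
  start : Reachable n initial
  step  : ∀ {s s'} x y → Reachable n s →
          ¬ HasPath (RedAdj s) 10 → ¬ HasPath (BlueAdj s) n →
          x ≢ y → ¬ Selected s x y →
          Respond s x y s' → Reachable n s'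

-- Painter's strategy maintains a height function on the vertices, with values
-- in 0..4, such that every red edge joins consecutive heights and every vertex
-- has at most one red neighbour one level below it; central vertices sit at
-- height at most 1 and outer ones at height at most 3, so each new red edge
-- can be hung below an existing vertex (or a small component re-rooted) while
-- keeping all heights at most 4.  Along a red path the heights have no local
-- maximum, since its two lower neighbours would both be parents of the peak;
-- so the path descends and then ascends, and has at most 4 + 4 edges.
module Submission where

open import Defs
open import Data.Nat using (ℕ; zero; suc; _+_; _≤_; _<_; z≤n; s≤s; _≟_)
open import Data.Nat.Properties
  using (≤-refl; ≤-trans; <⇒≤; <-irrefl; 1+n≢n; +-suc; +-identityʳ; m≤m+n; m≤n+m; +-monoˡ-≤)
open import Data.Nat.DivMod using (_mod_; m<n⇒m%n≡m)
open import Data.Fin using (toℕ)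
open import Data.Fin.Properties using (toℕ-fromℕ<)
open import Data.List.Relation.Unary.Any using (here; there)
import Data.List.Relation.Unary.Any as Any
open import Data.Maybe using (Maybe; just; nothing)
open import Data.Product using (_×_; _,_; proj₁; proj₂)
open import Data.Sum using (_⊎_; inj₁; inj₂; swap)
open import Data.Empty using (⊥; ⊥-elim)
open import Function using (_∘_)
open import Relation.Nullary using (¬_; Dec; yes; no)
open import Relation.Binary.Definitions using (Symmetric)
open import Relation.Binary.PropositionalEquality
  using (_≡_; _≢_; _≗_; refl; sym; trans; cong; subst)
open import Relation.Binary.Construct.Closure.ReflexiveTransitive using (Star; ε; _◅_)

2+n≢n : ∀ {n} → suc (suc n) ≢ n
2+n≢n ()

valley-length : ∀ {ℓ b} (g : ℕ → ℕ) →
  (∀ i → i < ℓ → g (suc i) ≡ suc (g i) ⊎ g i ≡ suc (g (suc i))) →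
  (∀ i → suc i < ℓ → g (suc i) ≡ suc (g i) → g (suc i) ≢ suc (g (suc (suc i)))) →
  (∀ i → g i ≤ b) → ℓ ≤ b + b
valley-length {ℓ} {b} g unit-step no-peak bounded = final (phase ℓ ≤-refl)
  where
  RisesInto : ℕ → Set
  RisesInto zero = ⊥
  RisesInto (suc i) = g (suc i) ≡ suc (g i)

  -- While descending g i + i stays equal to g 0; once the walk has risen it
  -- can only keep rising, and i ≤ g i + b.
  Phase : ℕ → Set
  Phase i = g i + i ≡ g 0 ⊎ (RisesInto i × i ≤ g i + b)

  next : ∀ i → i < ℓ → Phase i → Phase (suc i)
  next i i<ℓ ph with unit-step i i<ℓ | ph
  ... | inj₁ up | inj₁ descending =
    inj₂ (up , subst (λ t → suc i ≤ t + b) (sym up) (s≤s (≤-trans i≤b (m≤n+m b (g i)))))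
    where
    i≤b : i ≤ b
    i≤b = ≤-trans (m≤n+m i (g i)) (subst (_≤ b) (sym descending) (bounded 0))
  ... | inj₁ up | inj₂ (_ , i≤) = inj₂ (up , subst (λ t → suc i ≤ t + b) (sym up) (s≤s i≤))
  ... | inj₂ down | inj₁ descending =
    inj₁ (trans (+-suc (g (suc i)) i) (trans (cong (_+ i) (sym down)) descending))
  ... | inj₂ down | inj₂ (rises , _) with i
  ...   | zero = ⊥-elim rises
  ...   | suc j = ⊥-elim (no-peak j i<ℓ rises down)

  phase : ∀ i → i ≤ ℓ → Phase i
  phase zero _ = inj₁ (+-identityʳ (g 0))
  phase (suc i) i<ℓ = next i i<ℓ (phase i (<⇒≤ i<ℓ))

  final : Phase ℓ → ℓ ≤ b + b
  final (inj₁ e) = ≤-trans (m≤n+m ℓ (g ℓ)) (subst (_≤ b + b) (sym e) (≤-trans (bounded 0) (m≤m+n b b)))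
  final (inj₂ (_ , ℓ≤)) = ≤-trans ℓ≤ (+-monoˡ-≤ b (bounded ℓ))

record Levelling (E : ℕ → ℕ → Set) (h : ℕ → ℕ) : Set where
  field
    adjacent : ∀ {a b} → E a b → h b ≡ suc (h a) ⊎ h a ≡ suc (h b)
    unique-parent : ∀ {v a b} → E v a → E v b → suc (h a) ≡ h v → suc (h b) ≡ h v → a ≡ b
open Levelling

levelling-irreflexive : ∀ {E h a} → Levelling E h → ¬ E a a
levelling-irreflexive L r with adjacent L r
... | inj₁ e = 1+n≢n (sym e)
... | inj₂ e = 1+n≢n (sym e)

path-length≤ : ∀ {E h b ℓ} → Symmetric E → Levelling E h → (∀ v → h v ≤ b) →
               HasPath E (suc ℓ) → ℓ ≤ b + b
path-length≤ {E} {h} {b} {ℓ} E-sym L bounded (f , f-injective , f-edge) =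
  valley-length (h ∘ vertex) unit-step no-peak (bounded ∘ vertex)
  where
  -- For i ≤ ℓ the reduction modulo ℓ + 1 does nothing; it only makes vertex total.
  vertex : ℕ → ℕ
  vertex i = f (i mod suc ℓ)

  position : ∀ {i} → i ≤ ℓ → toℕ (i mod suc ℓ) ≡ i
  position i≤ℓ = trans (toℕ-fromℕ< _) (m<n⇒m%n≡m (s≤s i≤ℓ))

  edge : ∀ {i} → i < ℓ → E (vertex i) (vertex (suc i))
  edge i<ℓ = f-edge _ _ (trans (position i<ℓ) (cong suc (sym (position (<⇒≤ i<ℓ)))))

  unit-step : ∀ i → i < ℓ →
              h (vertex (suc i)) ≡ suc (h (vertex i)) ⊎ h (vertex i) ≡ suc (h (vertex (suc i)))
  unit-step i i<ℓ = adjacent L (edge i<ℓ)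

  peak-collapses : ∀ i → suc i < ℓ → h (vertex (suc i)) ≡ suc (h (vertex i)) →
                   h (vertex (suc i)) ≡ suc (h (vertex (suc (suc i)))) → i ≡ suc (suc i)
  peak-collapses i i+1<ℓ up down =
    trans (sym (position (<⇒≤ (<⇒≤ i+1<ℓ))))
      (trans (cong toℕ (f-injective (unique-parent L (E-sym (edge (<⇒≤ i+1<ℓ))) (edge i+1<ℓ)
                                       (sym up) (sym down))))
             (position i+1<ℓ))

  no-peak : ∀ i → suc i < ℓ → h (vertex (suc i)) ≡ suc (h (vertex i)) →
            h (vertex (suc i)) ≢ suc (h (vertex (suc (suc i))))
  no-peak i i+1<ℓ up down = 2+n≢n (sym (peak-collapses i i+1<ℓ up down))

infixl 9 _[_↦_]
_[_↦_] : (ℕ → ℕ) → ℕ → ℕ → ℕ → ℕ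
(h [ v ↦ k ]) u with u ≟ v
... | yes _ = k
... | no _ = h u

update-≡ : ∀ h v {k} → (h [ v ↦ k ]) v ≡ k
update-≡ h v with v ≟ v
... | yes _ = refl
... | no v≢v = ⊥-elim (v≢v refl)

update-≢ : ∀ h {u v k} → u ≢ v → (h [ v ↦ k ]) u ≡ h u
update-≢ h {u} {v} u≢v with u ≟ v
... | yes u≡v = ⊥-elim (u≢v u≡v)
... | no _ = refl

update-comm : ∀ {a b} h i j → a ≢ b → h [ a ↦ i ] [ b ↦ j ] ≗ h [ b ↦ j ] [ a ↦ i ]
update-comm {a} {b} h i j a≢b u = by-cases (u ≟ a) (u ≟ b)
  where
  by-cases : Dec (u ≡ a) → Dec (u ≡ b) → (h [ a ↦ i ] [ b ↦ j ]) u ≡ (h [ b ↦ j ] [ a ↦ i ]) u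
  by-cases (yes refl) (yes refl) = ⊥-elim (a≢b refl)
  by-cases (yes refl) (no u≢b) = trans (trans (update-≢ _ u≢b) (update-≡ h a)) (sym (update-≡ _ a))
  by-cases (no u≢a) (yes refl) = trans (update-≡ _ b) (sym (trans (update-≢ _ u≢a) (update-≡ h b)))
  by-cases (no u≢a) (no u≢b) =
    trans (trans (update-≢ _ u≢b) (update-≢ h u≢a)) (sym (trans (update-≢ _ u≢a) (update-≢ h u≢b)))

levelling-⊆ : ∀ {E E′ h} → (∀ {a b} → E′ a b → E a b) → Levelling E h → Levelling E′ h
levelling-⊆ E′⊆E L = record
  { adjacent = adjacent L ∘ E′⊆E
  ; unique-parent = λ ra rb → unique-parent L (E′⊆E ra) (E′⊆E rb)
  }

levelling-congruent : ∀ {E h h′} → Symmetric E → (∀ {a b} → E a b → h′ a ≡ h a) →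
                      Levelling E h → Levelling E h′
levelling-congruent {E} {h} {h′} E-sym agree L = record { adjacent = adjacent′ ; unique-parent = parent′ }
  where
  adjacent′ : ∀ {a b} → E a b → h′ b ≡ suc (h′ a) ⊎ h′ a ≡ suc (h′ b)
  adjacent′ r rewrite agree r | agree (E-sym r) = adjacent L r

  old-parent : ∀ {v a} → E v a → suc (h′ a) ≡ h′ v → suc (h a) ≡ h v
  old-parent r e = trans (cong suc (sym (agree (E-sym r)))) (trans e (agree r))

  parent′ : ∀ {v a b} → E v a → E v b → suc (h′ a) ≡ h′ v → suc (h′ b) ≡ h′ v → a ≡ b
  parent′ ra rb ea eb = unique-parent L ra rb (old-parent ra ea) (old-parent rb eb)

levelling-isolated : ∀ {E h v} k → Symmetric E → (∀ {w} → ¬ E v w) →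
                     Levelling E h → Levelling E (h [ v ↦ k ])
levelling-isolated {E} {h} {v} k E-sym isolated = levelling-congruent E-sym unchanged
  where
  unchanged : ∀ {a b} → E a b → (h [ v ↦ k ]) a ≡ h a
  unchanged r = update-≢ h λ { refl → isolated r }

component-neighbour : ∀ {E h x w z} → Levelling E h → (∀ z → Star E x z → z ≡ x ⊎ z ≡ w) →
                      E x z → z ≡ w
component-neighbour L component r with component _ (r ◅ ε)
... | inj₁ refl = ⊥-elim (levelling-irreflexive L r)
... | inj₂ z≡w = z≡w

levelling-reroot : ∀ {E h x w} k → Symmetric E → E x w → (∀ z → Star E x z → z ≡ x ⊎ z ≡ w) →
                   Levelling E h → Levelling E (h [ w ↦ suc k ] [ x ↦ k ])
levelling-reroot {E} {h} {x} {w} k E-sym xw component L =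
  record { adjacent = adjacent′ ; unique-parent = parent′ }
  where
  h′ : ℕ → ℕ
  h′ = h [ w ↦ suc k ] [ x ↦ k ]

  w-above-x : h′ w ≡ suc (h′ x)
  w-above-x = trans (update-≢ _ w≢x) (trans (update-≡ h w) (cong suc (sym (update-≡ _ x))))
    where
    w≢x : w ≢ x
    w≢x refl = levelling-irreflexive L xw

  neighbour-of-x : ∀ {z} → E x z → z ≡ w
  neighbour-of-x = component-neighbour L component

  neighbour-of-w : ∀ {z} → E w z → z ≡ x
  neighbour-of-w r = component-neighbour L (λ z c → swap (component z (xw ◅ c))) r

  Outside : ℕ → Set
  Outside a = a ≢ x × a ≢ w

  outside-neighbour : ∀ {a b} → Outside a → E a b → Outside b
  outside-neighbour (a≢x , a≢w) r =
    (λ { refl → a≢w (neighbour-of-x (E-sym r)) }) , (λ { refl → a≢x (neighbour-of-w (E-sym r)) })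

  unchanged : ∀ {a} → Outside a → h′ a ≡ h a
  unchanged (a≢x , a≢w) = trans (update-≢ _ a≢x) (update-≢ h a≢w)

  inside-or-outside : ∀ a → a ≡ x ⊎ a ≡ w ⊎ Outside a
  inside-or-outside a with a ≟ x | a ≟ w
  ... | yes a≡x | _ = inj₁ a≡x
  ... | no _ | yes a≡w = inj₂ (inj₁ a≡w)
  ... | no a≢x | no a≢w = inj₂ (inj₂ (a≢x , a≢w))

  adjacent′ : ∀ {a b} → E a b → h′ b ≡ suc (h′ a) ⊎ h′ a ≡ suc (h′ b)
  adjacent′ {a} r with inside-or-outside a
  ... | inj₁ refl rewrite neighbour-of-x r = inj₁ w-above-x
  ... | inj₂ (inj₁ refl) rewrite neighbour-of-w r = inj₂ w-above-x
  ... | inj₂ (inj₂ out)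
    rewrite unchanged out | unchanged (outside-neighbour out r) = adjacent L r

  parent′ : ∀ {v a b} → E v a → E v b → suc (h′ a) ≡ h′ v → suc (h′ b) ≡ h′ v → a ≡ b
  parent′ {v} ra rb ea eb with inside-or-outside v
  ... | inj₁ refl = trans (neighbour-of-x ra) (sym (neighbour-of-x rb))
  ... | inj₂ (inj₁ refl) = trans (neighbour-of-w ra) (sym (neighbour-of-w rb))
  ... | inj₂ (inj₂ out) = unique-parent L ra rb (old-parent ra ea) (old-parent rb eb)
    where
    old-parent : ∀ {c} → E v c → suc (h′ c) ≡ h′ v → suc (h c) ≡ h v
    old-parent r e =
      trans (cong suc (sym (unchanged (outside-neighbour out r)))) (trans e (unchanged out))

levelling-add-edge : ∀ {E E′ h x y} →
  (∀ {a b} → E′ a b → ((x ≡ a × y ≡ b) ⊎ (x ≡ b × y ≡ a)) ⊎ E a b) →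
  h y ≡ suc (h x) → (∀ {c} → E y c → h c ≡ suc (h y)) → Levelling E h → Levelling E′ h
levelling-add-edge {E} {E′} {h} {x} {y} E′⊆E+xy y-above-x children-of-y L =
  record { adjacent = adjacent′ ; unique-parent = parent′ }
  where
  adjacent′ : ∀ {a b} → E′ a b → h b ≡ suc (h a) ⊎ h a ≡ suc (h b)
  adjacent′ r with E′⊆E+xy r
  ... | inj₁ (inj₁ (refl , refl)) = inj₁ y-above-x
  ... | inj₁ (inj₂ (refl , refl)) = inj₂ y-above-x
  ... | inj₂ r′ = adjacent L r′

  y-not-below-x : suc (h y) ≢ h x
  y-not-below-x e = 2+n≢n (trans (cong suc (sym y-above-x)) e)

  no-old-parent : ∀ {c} → E y c → suc (h c) ≢ h y
  no-old-parent r e = 2+n≢n (trans (cong suc (sym (children-of-y r))) e)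

  parent′ : ∀ {v a b} → E′ v a → E′ v b → suc (h a) ≡ h v → suc (h b) ≡ h v → a ≡ b
  parent′ ra rb ea eb with E′⊆E+xy ra | E′⊆E+xy rb
  ... | inj₁ (inj₁ (refl , refl)) | _ = ⊥-elim (y-not-below-x ea)
  ... | _ | inj₁ (inj₁ (refl , refl)) = ⊥-elim (y-not-below-x eb)
  ... | inj₁ (inj₂ (refl , refl)) | inj₁ (inj₂ (refl , refl)) = refl
  ... | inj₁ (inj₂ (refl , refl)) | inj₂ rb′ = ⊥-elim (no-old-parent rb′ eb)
  ... | inj₂ ra′ | inj₁ (inj₂ (refl , refl)) = ⊥-elim (no-old-parent ra′ ea)
  ... | inj₂ ra′ | inj₂ rb′ = unique-parent L ra′ rb′ ea eb

LabelFits : Maybe Label → ℕ → Set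
LabelFits (just central) k = k ≤ 1
LabelFits (just outer) k = k ≤ 3
LabelFits _ k = k ≤ 4

Fits : (ℕ → Maybe Label) → (ℕ → ℕ) → Set
Fits f h = ∀ u → LabelFits (f u) (h u)

label-fits⇒≤4 : ∀ m {k} → LabelFits m k → k ≤ 4
label-fits⇒≤4 (just central) k≤1 = ≤-trans k≤1 (s≤s z≤n)
label-fits⇒≤4 (just outer) k≤3 = ≤-trans k≤3 (s≤s (s≤s (s≤s z≤n)))
label-fits⇒≤4 (just terminal) k≤4 = k≤4
label-fits⇒≤4 nothing k≤4 = k≤4

≤1⇒label-fits : ∀ m {k} → k ≤ 1 → LabelFits m k
≤1⇒label-fits (just central) k≤1 = k≤1
≤1⇒label-fits (just outer) k≤1 = ≤-trans k≤1 (s≤s z≤n)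
≤1⇒label-fits (just terminal) k≤1 = ≤-trans k≤1 (s≤s z≤n)
≤1⇒label-fits nothing k≤1 = ≤-trans k≤1 (s≤s z≤n)

fits-lower : ∀ {f h v k} → k ≤ 1 → Fits f h → Fits f (h [ v ↦ k ])
fits-lower {f} {h} {v} {k} k≤1 F u with u ≟ v
... | yes _ = ≤1⇒label-fits (f u) k≤1
... | no _ = F u

fits-relabel : ∀ {f h v k} l → LabelFits (just l) k → Fits f h → Fits (relabel f v l) (h [ v ↦ k ])
fits-relabel {v = v} l fits F u with u ≟ v
... | yes _ = fits
... | no _ = F u

fits-resp-≗ : ∀ {f h h′} → h ≗ h′ → Fits f h → Fits f h′
fits-resp-≗ {f} h≗h′ F u = subst (LabelFits (f u)) (h≗h′ u) (F u)

RedAdj-sym : ∀ s → Symmetric (RedAdj s)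
RedAdj-sym s = Any.map λ { {mv _ _ _} (e , col) → swap e , col }

RedAdj-addRed : ∀ {s x y a b} → RedAdj (addEdge red s x y) a b →
                ((x ≡ a × y ≡ b) ⊎ (x ≡ b × y ≡ a)) ⊎ RedAdj s a b
RedAdj-addRed (here (e , _)) = inj₁ e
RedAdj-addRed (there r) = inj₂ r

RedAdj-addBlue : ∀ {s x y a b} → RedAdj (addEdge blue s x y) a b → RedAdj s a b
RedAdj-addBlue (here (_ , ()))
RedAdj-addBlue (there r) = r

SmallWith-sym : ∀ {s x w} → SmallWith s x w → SmallWith s w x
SmallWith-sym {s} (xw , component) = RedAdj-sym s xw , λ z c → swap (component z (xw ◅ c))

record Levelled (s : State) : Set where
  constructor levelled
  field
    height : ℕ → ℕ
    levelling : Levelling (RedAdj s) height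
    fits : Fits (label s) height
open Levelled

labelled-height : ∀ {s h x l} → Fits (label s) h → HasLabel l s x → LabelFits (just l) (h x)
labelled-height {h = h} {x} F (_ , lx) = subst (λ m → LabelFits m (h x)) lx (F x)

new-component : ∀ {s x y} → Levelled s → x ≢ y → NoRed s x → NoRed s y →
                Levelled (addEdge red s x y)
new-component {s} {x} {y} (levelled h L F) x≢y nx ny =
  levelled h′ (levelling-add-edge (RedAdj-addRed {s}) y-above-x (⊥-elim ∘ ny ∘ (_ ,_)) L′)
    (fits-lower (s≤s z≤n) (fits-lower z≤n F))
  where
  h′ : ℕ → ℕ
  h′ = h [ x ↦ 0 ] [ y ↦ 1 ]
  L′ : Levelling (RedAdj s) h′
  L′ = levelling-isolated 1 (RedAdj-sym s) (ny ∘ (_ ,_)) (levelling-isolated 0 (RedAdj-sym s) (nx ∘ (_ ,_)) L)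
  y-above-x : h′ y ≡ suc (h′ x)
  y-above-x = trans (update-≡ _ y) (cong suc (sym (trans (update-≢ _ x≢y) (update-≡ h x))))

attach-leaf : ∀ {s x y l} (L : Levelled s) → x ≢ y → NoRed s y →
              LabelFits (just l) (suc (height L x)) → Levelled (setLabel y l (addEdge red s x y))
attach-leaf {s} {x} {y} {l} (levelled h L F) x≢y ny fits =
  levelled h′ (levelling-add-edge (RedAdj-addRed {s}) y-above-x (⊥-elim ∘ ny ∘ (_ ,_)) L′)
    (fits-relabel l fits F)
  where
  h′ : ℕ → ℕ
  h′ = h [ y ↦ suc (h x) ]
  L′ : Levelling (RedAdj s) h′
  L′ = levelling-isolated (suc (h x)) (RedAdj-sym s) (ny ∘ (_ ,_)) L
  y-above-x : h′ y ≡ suc (h′ x)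
  y-above-x = trans (update-≡ h y) (cong suc (sym (update-≢ h x≢y)))

extend-small : ∀ {s x y w} → Levelled s → x ≢ y → SmallWith s x w → NoRed s y →
               Levelled (setLabel x central (setLabel w central (setLabel y central (addEdge red s x y))))
extend-small {s} {x} {y} {w} (levelled h L F) x≢y (xw , component) ny =
  levelled h′ (levelling-add-edge (RedAdj-addRed {s}) y-above-x (⊥-elim ∘ ny ∘ (_ ,_)) L′)
    (fits-relabel central z≤n (fits-relabel central ≤-refl (fits-relabel central ≤-refl F)))
  where
  h′ : ℕ → ℕ
  h′ = h [ y ↦ 1 ] [ w ↦ 1 ] [ x ↦ 0 ]
  L′ : Levelling (RedAdj s) h′
  L′ = levelling-reroot 0 (RedAdj-sym s) xw component
         (levelling-isolated 1 (RedAdj-sym s) (ny ∘ (_ ,_)) L)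
  y≢w : y ≢ w
  y≢w refl = ny (_ , RedAdj-sym s xw)
  y-above-x : h′ y ≡ suc (h′ x)
  y-above-x = trans (update-≢ _ (x≢y ∘ sym))
                (trans (update-≢ _ y≢w) (trans (update-≡ h y) (cong suc (sym (update-≡ _ x)))))

join-smalls : ∀ {s x y x′ y′} → Levelled s → x ≢ y → SmallWith s x x′ → SmallWith s y y′ →
              ¬ RedConn s x y →
              Levelled (setLabel x′ central (setLabel x central (setLabel y central
                         (setLabel y′ outer (addEdge red s x y)))))
join-smalls {s} {x} {y} {x′} {y′} (levelled h L F) x≢y (xx′ , x-component) (yy′ , y-component) x≁y =
  levelled h₂ (levelling-add-edge (RedAdj-addRed {s}) y-above-x children-of-y L₂)
    (fits-resp-≗ (update-comm h₁ 0 1 x≢x′)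
      (fits-relabel central ≤-refl (fits-relabel central z≤n (fits-relabel central ≤-refl
        (fits-relabel outer (s≤s (s≤s z≤n)) F)))))
  where
  h₁ h₂ : ℕ → ℕ
  h₁ = h [ y′ ↦ 2 ] [ y ↦ 1 ]
  h₂ = h₁ [ x′ ↦ 1 ] [ x ↦ 0 ]
  L₂ : Levelling (RedAdj s) h₂
  L₂ = levelling-reroot 0 (RedAdj-sym s) xx′ x-component
         (levelling-reroot 1 (RedAdj-sym s) yy′ y-component L)
  x≢x′ : x ≢ x′
  x≢x′ refl = levelling-irreflexive L xx′
  y≢x′ : y ≢ x′
  y≢x′ refl = x≁y (xx′ ◅ ε)
  y′≢x : y′ ≢ x
  y′≢x refl = x≁y (RedAdj-sym s yy′ ◅ ε)
  y′≢x′ : y′ ≢ x′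
  y′≢x′ refl = x≁y (xx′ ◅ RedAdj-sym s yy′ ◅ ε)
  y′≢y : y′ ≢ y
  y′≢y refl = levelling-irreflexive L yy′
  h₂y : h₂ y ≡ 1
  h₂y = trans (update-≢ _ (x≢y ∘ sym)) (trans (update-≢ _ y≢x′) (update-≡ _ y))
  h₂y′ : h₂ y′ ≡ 2
  h₂y′ = trans (update-≢ _ y′≢x) (trans (update-≢ _ y′≢x′) (trans (update-≢ _ y′≢y) (update-≡ h y′)))
  y-above-x : h₂ y ≡ suc (h₂ x)
  y-above-x = trans h₂y (cong suc (sym (update-≡ _ x)))
  children-of-y : ∀ {c} → RedAdj s y c → h₂ c ≡ suc (h₂ y)
  children-of-y r rewrite component-neighbour L y-component r = trans h₂y′ (cong suc (sym h₂y))

absorb-small : ∀ {s x y w} → Levelled s → x ≢ y → Central s x → SmallWith s y w →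
               Levelled (setLabel y outer (setLabel w outer (addEdge red s x y)))
absorb-small {s} {x} {y} {w} (levelled h L F) x≢y cx yw@(yw′ , component) =
  levelled h′ (levelling-add-edge (RedAdj-addRed {s}) y-above-x children-of-y L′)
    (fits-relabel outer (s≤s (≤-trans hx≤1 (s≤s z≤n))) (fits-relabel outer (s≤s (s≤s hx≤1)) F))
  where
  hx≤1 : h x ≤ 1
  hx≤1 = labelled-height F cx
  h′ : ℕ → ℕ
  h′ = h [ w ↦ suc (suc (h x)) ] [ y ↦ suc (h x) ]
  L′ : Levelling (RedAdj s) h′
  L′ = levelling-reroot (suc (h x)) (RedAdj-sym s) yw′ component L
  x≢w : x ≢ w
  x≢w refl = proj₂ (proj₁ cx) (y , SmallWith-sym {s} yw)
  w≢y : w ≢ y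
  w≢y refl = levelling-irreflexive L yw′
  y-above-x : h′ y ≡ suc (h′ x)
  y-above-x = trans (update-≡ _ y) (cong suc (sym (trans (update-≢ _ x≢y) (update-≢ h x≢w))))
  children-of-y : ∀ {c} → RedAdj s y c → h′ c ≡ suc (h′ y)
  children-of-y r rewrite component-neighbour L component r =
    trans (update-≢ _ w≢y) (trans (update-≡ h w) (cong suc (sym (update-≡ _ y))))

red-move : ∀ {s x y s′} → Levelled s → x ≢ y → RedMove s x y s′ → Levelled s′
red-move L x≢y (caseA (nx , ny)) = new-component L x≢y nx ny
red-move L x≢y (caseB _ xw ny) = extend-small L x≢y xw ny
red-move L x≢y (caseC _ _ xx′ yy′ x≁y) = join-smalls L x≢y xx′ yy′ x≁y
red-move L x≢y (caseD _ _ _ cx ny) =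
  attach-leaf L x≢y ny (s≤s (≤-trans (labelled-height (fits L) cx) (s≤s z≤n)))
red-move L x≢y (caseE _ _ _ _ cx yw) = absorb-small L x≢y cx yw
red-move L x≢y (caseF _ _ _ _ _ ox _ ny) = attach-leaf L x≢y ny (s≤s (labelled-height (fits L) ox))

respond : ∀ {s x y s′} → Levelled s → x ≢ y → Respond s x y s′ → Levelled s′
respond L x≢y (redXY m) = red-move L x≢y m
respond L x≢y (redYX m) = red-move L (x≢y ∘ sym) m
respond {s} (levelled h L F) _ (blueXY _) = levelled h (levelling-⊆ (RedAdj-addBlue {s}) L) F

reachable⇒levelled : ∀ {n s} → Reachable n s → Levelled s
reachable⇒levelled start = levelled (λ _ → 0) (record { adjacent = λ () ; unique-parent = λ () }) (λ _ → z≤n)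
reachable⇒levelled (step x y r _ _ x≢y _ resp) = respond (reachable⇒levelled r) x≢y resp

red-path-length≤8 : ∀ {s ℓ} → Levelled s → HasPath (RedAdj s) (suc ℓ) → ℓ ≤ 8
red-path-length≤8 {s} (levelled h L F) = path-length≤ (RedAdj-sym s) L (λ v → label-fits⇒≤4 (label s v) (F v))

lemma3p4 : (n : ℕ) → 1 ≤ n → ∀ s → Reachable n s → ¬ HasPath (RedAdj s) 10
lemma3p4 n _ s r = <-irrefl refl ∘ red-path-length≤8 (reachable⇒levelled r)
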